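{- For $n\ge 4$, the enhanced power graph $\mathcal{G}_e(\mathcal{A}_n)$ has no dominating vertex other than the identity. Consequently, for $n\ge 4$, the graphs $\mathcal{G}^*_e(\mathcal{A}_n)$ and $\mathcal{G}^{**}_e(\mathcal{A}_n)$ coincide.
   Context: $\mathcal{A}_n$ is the alternating group on $n$ letters. For a finite group $G$ with identity $e$, the enhanced power graph $\mathcal{G}_e(G)$ is the simple graph with vertex set $G$ in which two distinct vertices $u,v$ are adjacent iff there exists $w\in G$ such that both $u$ and $v$ are powers of $w$. A dominating vertex is a vertex adjacent to every other vertex. $\mathcal{G}^*_e(G)$ is the induced subgraph on $G\setminus\{e\}$, and $\mathcal{G}^{**}_e(G)$ is the induced subgraph obtained by deleting all dominating vertices. -}

module Defs where

open import Data.Nat using (ℕ; zero; suc; _%_)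
open import Data.Fin using (Fin; _<?_)
open import Data.Fin.Permutation using (Permutation′; _⟨$⟩ʳ_; _≈_; id; _∘ₚ_)
open import Data.List using (List; length; filter; cartesianProduct; allFin)
open import Data.Product using (_×_; _,_; ∃; ∃-syntax)
open import Relation.Nullary using (¬_)
open import Relation.Nullary.Decidable using (_×-dec_)
open import Relation.Binary.PropositionalEquality using (_≡_)

inversions : ∀ {n} → Permutation′ n → ℕ
inversions {n} σ =
  length (filter (λ p → (Data.Product.proj₁ p <? Data.Product.proj₂ p)
                        ×-dec ((σ ⟨$⟩ʳ Data.Product.proj₂ p) <? (σ ⟨$⟩ʳ Data.Product.proj₁ p)))
                 (cartesianProduct (allFin n) (allFin n)))

InA : ∀ {n} → Permutation′ n → Set
InA σ = inversions σ % 2 ≡ 0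

_^ₚ_ : ∀ {n} → Permutation′ n → ℕ → Permutation′ n
σ ^ₚ zero  = id
σ ^ₚ suc k = σ ∘ₚ (σ ^ₚ k)

IsPowerOf : ∀ {n} → Permutation′ n → Permutation′ n → Set
IsPowerOf u w = ∃[ k ] (u ≈ (w ^ₚ k))

EPAdj : ∀ {n} → Permutation′ n → Permutation′ n → Set
EPAdj {n} u v = (¬ (u ≈ v)) × (∃[ w ] (InA w × IsPowerOf u w × IsPowerOf v w))

Dominating : ∀ {n} → Permutation′ n → Set
Dominating {n} u = (v : Permutation′ n) → InA v → ¬ (v ≈ u) → EPAdj u v

module Submission where

-- Two powers of a common w commute, so a dominating vertex u commutes
-- with every even permutation c (if c = u this is trivial).  If u moved a
-- point x, pick an even c fixing exactly one of x and u x; commuting with u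
-- forces c to fix both, a contradiction.  Such separating even permutations
-- exist for n ≥ 4: lifts of 3-cycles (fixing the point 0) handle pairs
-- involving 0, induction on n handles the rest, and for n = 4 two explicit
-- 3-cycles suffice.

open import Defs
open import Data.Nat using (ℕ; zero; suc; _+_; _%_; _≤_; s≤s)
open import Data.Nat.Properties using (+-comm)
open import Data.Bool using (Bool; true; false; _∧_)
open import Data.Fin using (Fin; zero; suc; _<_)
open import Data.Fin.Properties using (_<?_; <-asym; suc-injective; _≟_; all?)
open import Data.Fin.Permutation
  using (Permutation′; permutation; _⟨$⟩ʳ_; _⟨$⟩ˡ_; inverseˡ; inverseʳ; _≈_; id)
open import Data.List using (length; filter; cartesianProduct; tabulate; map; _++_)
open import Data.List.Properties using (filter-++; length-++; map-tabulate)
open import Data.Product using (Σ; _×_; _,_; proj₁; proj₂)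
open import Data.Sum using (_⊎_; inj₁; inj₂)
open import Data.Empty using (⊥; ⊥-elim)
open import Function using (_∘_)
open import Relation.Nullary using (¬_; Dec; does; yes; no)
open import Relation.Nullary.Decidable using (_×-dec_)
open import Relation.Unary using (Decidable)
open import Relation.Binary.PropositionalEquality

countTrue : ∀ {n} → (Fin n → Bool) → ℕ
countTrue {zero}  f = 0
countTrue {suc n} f = indicator (f zero) + countTrue (f ∘ suc)
  where
  indicator : Bool → ℕ
  indicator true  = 1
  indicator false = 0

sumFin : ∀ {n} → (Fin n → ℕ) → ℕ
sumFin {zero}  f = 0
sumFin {suc n} f = f zero + sumFin (f ∘ suc)

countTrue-false : ∀ {n} (f : Fin n → Bool) → (∀ i → f i ≡ false) → countTrue f ≡ 0
countTrue-false {zero}  f h = refl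
countTrue-false {suc n} f h rewrite h zero = countTrue-false (f ∘ suc) (h ∘ suc)

sumFin-zero : ∀ {n} (f : Fin n → ℕ) → (∀ i → f i ≡ 0) → sumFin f ≡ 0
sumFin-zero {zero}  f h = refl
sumFin-zero {suc n} f h rewrite h zero = sumFin-zero (f ∘ suc) (h ∘ suc)

length-filter-tabulate : ∀ {a p} {A : Set a} {P : A → Set p} (P? : Decidable P)
  {n} (f : Fin n → A) →
  length (filter P? (tabulate f)) ≡ countTrue (λ i → does (P? (f i)))
length-filter-tabulate P? {zero}  f = refl
length-filter-tabulate P? {suc n} f with does (P? (f zero))
... | true  = cong suc (length-filter-tabulate P? (f ∘ suc))
... | false = length-filter-tabulate P? (f ∘ suc)

length-filter-product : ∀ {a p} {A : Set a} {P : A × A → Set p} (P? : Decidable P)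
  {n m} (f : Fin n → A) (g : Fin m → A) →
  length (filter P? (cartesianProduct (tabulate f) (tabulate g)))
    ≡ sumFin (λ i → countTrue (λ j → does (P? (f i , g j))))
length-filter-product P? {zero}  f g = refl
length-filter-product P? {suc n} f g = begin
    length (filter P? (row ++ rest))
      ≡⟨ cong length (filter-++ P? row rest) ⟩
    length (filter P? row ++ filter P? rest)
      ≡⟨ length-++ (filter P? row) ⟩
    length (filter P? row) + length (filter P? rest)
      ≡⟨ cong₂ _+_ rowCount (length-filter-product P? (f ∘ suc) g) ⟩
    sumFin (λ i → countTrue (λ j → does (P? (f i , g j)))) ∎
  where
  open ≡-Reasoning
  row  = map (f zero ,_) (tabulate g)
  rest = cartesianProduct (tabulate (f ∘ suc)) (tabulate g)
  rowCount : length (filter P? row) ≡ countTrue (λ j → does (P? (f zero , g j)))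
  rowCount = trans (cong (length ∘ filter P?) (map-tabulate g (f zero ,_)))
                   (length-filter-tabulate P? ((f zero ,_) ∘ g))

isInversion : ∀ {n} → Permutation′ n → Fin n → Fin n → Bool
isInversion σ p q = does ((p <? q) ×-dec ((σ ⟨$⟩ʳ q) <? (σ ⟨$⟩ʳ p)))

inversionSum : ∀ {n} → Permutation′ n → ℕ
inversionSum σ = sumFin (λ p → countTrue (isInversion σ p))

inversions≡inversionSum : ∀ {n} (σ : Permutation′ n) → inversions σ ≡ inversionSum σ
inversions≡inversionSum {n} σ =
  length-filter-product (λ p → (proj₁ p <? proj₂ p) ×-dec ((σ ⟨$⟩ʳ proj₂ p) <? (σ ⟨$⟩ʳ proj₁ p)))
    {n} {n} (λ i → i) (λ i → i)

even-by-inversionSum : ∀ {n} (σ : Permutation′ n) → inversionSum σ % 2 ≡ 0 → InA σ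
even-by-inversionSum σ h rewrite inversions≡inversionSum σ = h

no-inversion-if-fixed : ∀ {n} (σ : Permutation′ n) (p q : Fin n) →
  σ ⟨$⟩ʳ p ≡ p → σ ⟨$⟩ʳ q ≡ q → isInversion σ p q ≡ false
no-inversion-if-fixed σ p q fp fq rewrite fp | fq = asym (p <? q) (q <? p)
  where
  asym : (d : Dec (p < q)) (e : Dec (q < p)) → (does d ∧ does e) ≡ false
  asym (yes a) (yes b) = ⊥-elim (<-asym a b)
  asym (yes _) (no _)  = refl
  asym (no _)  _       = refl

even-id : ∀ {n} → InA {n} id
even-id {n} = even-by-inversionSum {n} id (cong (_% 2)
  (sumFin-zero {n} _ (λ p → countTrue-false {n} _ (λ q → no-inversion-if-fixed id p q refl refl))))

lift : ∀ {n} → Permutation′ n → Permutation′ (suc n)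
lift σ = permutation (liftFun (σ ⟨$⟩ʳ_)) (liftFun (σ ⟨$⟩ˡ_)) right left
  where
  liftFun : ∀ {n} → (Fin n → Fin n) → Fin (suc n) → Fin (suc n)
  liftFun f zero    = zero
  liftFun f (suc i) = suc (f i)
  right : ∀ y → liftFun (σ ⟨$⟩ʳ_) (liftFun (σ ⟨$⟩ˡ_) y) ≡ y
  right zero    = refl
  right (suc y) = cong suc (inverseʳ σ)
  left : ∀ y → liftFun (σ ⟨$⟩ˡ_) (liftFun (σ ⟨$⟩ʳ_) y) ≡ y
  left zero    = refl
  left (suc y) = cong suc (inverseˡ σ)

-- Row 0 of the lift has no inversions and the other rows are those of σ.
inversionSum-lift : ∀ {n} (σ : Permutation′ n) → inversionSum (lift σ) ≡ inversionSum σ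
inversionSum-lift {n} σ = cong (_+ inversionSum σ) (countTrue-false {n} (λ _ → false) (λ _ → refl))

even-lift : ∀ {n} (σ : Permutation′ n) → InA σ → InA (lift σ)
even-lift σ h = even-by-inversionSum (lift σ)
  (trans (cong (_% 2) (inversionSum-lift σ)) (subst (λ k → k % 2 ≡ 0) (inversions≡inversionSum σ) h))

cycle012 : ∀ m → Permutation′ (suc (suc (suc m)))
cycle012 m = permutation forward backward right left
  where
  forward backward : Fin (suc (suc (suc m))) → Fin (suc (suc (suc m)))
  forward zero                = suc zero
  forward (suc zero)          = suc (suc zero)
  forward (suc (suc zero))    = zero
  forward (suc (suc (suc z))) = suc (suc (suc z))
  backward zero                = suc (suc zero)
  backward (suc zero)          = zero
  backward (suc (suc zero))    = suc zero
  backward (suc (suc (suc z))) = suc (suc (suc z))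
  right : ∀ y → forward (backward y) ≡ y
  right zero                = refl
  right (suc zero)          = refl
  right (suc (suc zero))    = refl
  right (suc (suc (suc z))) = refl
  left : ∀ y → backward (forward y) ≡ y
  left zero                = refl
  left (suc zero)          = refl
  left (suc (suc zero))    = refl
  left (suc (suc (suc z))) = refl

-- (0 1 2) has exactly the two inversions (0 , 2) and (1 , 2); rows from 3 on
-- are empty because the cycle fixes every point ≥ 3.
even-cycle012 : ∀ m → InA (cycle012 m)
even-cycle012 m = even-by-inversionSum (cycle012 m) (cong (_% 2) twoInversions)
  where
  twoInversions : inversionSum (cycle012 m) ≡ 2
  twoInversions
    rewrite countTrue-false {m} (λ _ → false) (λ _ → refl)
          | sumFin-zero (λ p → countTrue (isInversion (cycle012 m) (suc (suc (suc p)))))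
              (λ p → countTrue-false _ (λ q →
                no-inversion-if-fixed (cycle012 m) (suc (suc (suc p))) (suc (suc (suc q))) refl refl))
    = refl

cycle013 : Permutation′ 4
cycle013 = permutation forward backward right left
  where
  forward backward : Fin 4 → Fin 4
  forward zero                   = suc zero
  forward (suc zero)             = suc (suc (suc zero))
  forward (suc (suc zero))       = suc (suc zero)
  forward (suc (suc (suc zero))) = zero
  backward zero                   = suc (suc (suc zero))
  backward (suc zero)             = zero
  backward (suc (suc zero))       = suc (suc zero)
  backward (suc (suc (suc zero))) = suc zero
  right : ∀ y → forward (backward y) ≡ y
  right zero                   = refl
  right (suc zero)             = refl
  right (suc (suc zero))       = refl
  right (suc (suc (suc zero))) = refl
  left : ∀ y → backward (forward y) ≡ y
  left zero                   = refl
  left (suc zero)             = refl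
  left (suc (suc zero))       = refl
  left (suc (suc (suc zero))) = refl

even-cycle013 : InA cycle013
even-cycle013 = refl

Separates : ∀ {n} → Permutation′ n → Fin n → Fin n → Set
Separates c x y = (c ⟨$⟩ʳ x ≡ x × ¬ c ⟨$⟩ʳ y ≡ y) ⊎ (¬ c ⟨$⟩ʳ x ≡ x × c ⟨$⟩ʳ y ≡ y)

EvenSeparable : ∀ {n} → Fin n → Fin n → Set
EvenSeparable {n} x y = Σ (Permutation′ n) λ c → InA c × Separates c x y

separable-sym : ∀ {n} {x y : Fin n} → EvenSeparable x y → EvenSeparable y x
separable-sym (c , even , inj₁ (fx , my)) = c , even , inj₂ (my , fx)
separable-sym (c , even , inj₂ (mx , fy)) = c , even , inj₁ (fy , mx)

separable-lift : ∀ {n} {x y : Fin n} → EvenSeparable x y → EvenSeparable (suc x) (suc y)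
separable-lift (c , even , inj₁ (fx , my)) =
  lift c , even-lift c even , inj₁ (cong suc fx , my ∘ suc-injective)
separable-lift (c , even , inj₂ (mx , fy)) =
  lift c , even-lift c even , inj₂ (mx ∘ suc-injective , cong suc fy)

-- For n ≥ 3 every point is moved by an even permutation: by (0 1 2) if it is
-- one of 0, 1, 2, and otherwise by the lift of one moving its predecessor.
movedByEven : ∀ m (p : Fin (suc (suc (suc m)))) →
  Σ (Permutation′ (suc (suc (suc m)))) λ c → InA c × ¬ c ⟨$⟩ʳ p ≡ p
movedByEven m zero             = cycle012 m , even-cycle012 m , λ ()
movedByEven m (suc zero)       = cycle012 m , even-cycle012 m , λ ()
movedByEven m (suc (suc zero)) = cycle012 m , even-cycle012 m , λ ()
movedByEven (suc m) (suc (suc (suc z))) with movedByEven m (suc (suc z))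
... | c , even , moves = lift c , even-lift c even , moves ∘ suc-injective

-- The three pairs among the points 1, 2, 3 of Fin 4: (0 1 2) fixes only 3,
-- (0 1 3) fixes only 2.
separable-Fin4 : ∀ (x y : Fin 3) → ¬ x ≡ y → EvenSeparable {4} (suc x) (suc y)
separable-Fin4 zero             zero             x≢y = ⊥-elim (x≢y refl)
separable-Fin4 zero             (suc zero)       _   = cycle013 , even-cycle013 , inj₂ ((λ ()) , refl)
separable-Fin4 zero             (suc (suc zero)) _   = cycle012 1 , even-cycle012 1 , inj₂ ((λ ()) , refl)
separable-Fin4 (suc zero)       zero             _   = cycle013 , even-cycle013 , inj₁ (refl , λ ())
separable-Fin4 (suc zero)       (suc zero)       x≢y = ⊥-elim (x≢y refl)
separable-Fin4 (suc zero)       (suc (suc zero)) _   = cycle012 1 , even-cycle012 1 , inj₂ ((λ ()) , refl)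
separable-Fin4 (suc (suc zero)) zero             _   = cycle012 1 , even-cycle012 1 , inj₁ (refl , λ ())
separable-Fin4 (suc (suc zero)) (suc zero)       _   = cycle012 1 , even-cycle012 1 , inj₁ (refl , λ ())
separable-Fin4 (suc (suc zero)) (suc (suc zero)) x≢y = ⊥-elim (x≢y refl)

separable : ∀ m (x y : Fin (suc (suc (suc (suc m))))) → ¬ x ≡ y → EvenSeparable x y
separable m zero zero x≢y = ⊥-elim (x≢y refl)
separable m zero (suc q) _ with movedByEven m q
... | c , even , moves = lift c , even-lift c even , inj₁ (refl , moves ∘ suc-injective)
separable m (suc x) zero x≢y = separable-sym (separable m zero (suc x) (x≢y ∘ sym))
separable zero    (suc x) (suc y) x≢y = separable-Fin4 x y (x≢y ∘ cong suc)
separable (suc m) (suc x) (suc y) x≢y = separable-lift (separable m x y (x≢y ∘ cong suc))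

Commute : ∀ {n} → Permutation′ n → Permutation′ n → Set
Commute c u = ∀ z → c ⟨$⟩ʳ (u ⟨$⟩ʳ z) ≡ u ⟨$⟩ʳ (c ⟨$⟩ʳ z)

power-add : ∀ {n} (w : Permutation′ n) a b z →
  (w ^ₚ a) ⟨$⟩ʳ ((w ^ₚ b) ⟨$⟩ʳ z) ≡ (w ^ₚ (a + b)) ⟨$⟩ʳ z
power-add w zero    b z = refl
power-add w (suc a) b z =
  trans (cong ((w ^ₚ a) ⟨$⟩ʳ_) (shift b z)) (power-add w a b (w ⟨$⟩ʳ z))
  where
  shift : ∀ b z → w ⟨$⟩ʳ ((w ^ₚ b) ⟨$⟩ʳ z) ≡ (w ^ₚ b) ⟨$⟩ʳ (w ⟨$⟩ʳ z)
  shift zero    z = refl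
  shift (suc b) z = shift b (w ⟨$⟩ʳ z)

powers-commute : ∀ {n} (w c u : Permutation′ n) a b →
  u ≈ (w ^ₚ a) → c ≈ (w ^ₚ b) → Commute c u
powers-commute w c u a b u≈ c≈ z = begin
    c ⟨$⟩ʳ (u ⟨$⟩ʳ z)                  ≡⟨ c≈ _ ⟩
    (w ^ₚ b) ⟨$⟩ʳ (u ⟨$⟩ʳ z)           ≡⟨ cong ((w ^ₚ b) ⟨$⟩ʳ_) (u≈ z) ⟩
    (w ^ₚ b) ⟨$⟩ʳ ((w ^ₚ a) ⟨$⟩ʳ z)    ≡⟨ power-add w b a z ⟩
    (w ^ₚ (b + a)) ⟨$⟩ʳ z              ≡⟨ cong (λ k → (w ^ₚ k) ⟨$⟩ʳ z) (+-comm b a) ⟩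
    (w ^ₚ (a + b)) ⟨$⟩ʳ z              ≡⟨ sym (power-add w a b z) ⟩
    (w ^ₚ a) ⟨$⟩ʳ ((w ^ₚ b) ⟨$⟩ʳ z)    ≡⟨ sym (u≈ _) ⟩
    u ⟨$⟩ʳ ((w ^ₚ b) ⟨$⟩ʳ z)           ≡⟨ cong (u ⟨$⟩ʳ_) (sym (c≈ z)) ⟩
    u ⟨$⟩ʳ (c ⟨$⟩ʳ z)                  ∎
  where open ≡-Reasoning

equal-commute : ∀ {n} {c u : Permutation′ n} → c ≈ u → Commute c u
equal-commute {u = u} c≈u z = trans (c≈u (u ⟨$⟩ʳ z)) (cong (u ⟨$⟩ʳ_) (sym (c≈u z)))

-- A dominating vertex u commutes with every even c: either c = u, or c is
-- adjacent to u, so that both are powers of a common w.  (Equality of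
-- permutations of Fin n is decidable, pointwise.)
dominating-commutes : ∀ {n} (u c : Permutation′ n) → Dominating u → InA c → Commute c u
dominating-commutes u c dom even with all? (λ i → c ⟨$⟩ʳ i ≟ u ⟨$⟩ʳ i)
... | yes c≈u = equal-commute {c = c} {u} c≈u
... | no c≉u with dom c even c≉u
...   | _ , w , _ , (a , u≈wᵃ) , (b , c≈wᵇ) = powers-commute w c u a b u≈wᵃ c≈wᵇ

-- If c commutes with u, then c fixes x iff it fixes u x, so it cannot
-- separate x from u x.
commuting-not-separating : ∀ {n} (c u : Permutation′ n) x →
  Commute c u → ¬ Separates c x (u ⟨$⟩ʳ x)
commuting-not-separating c u x comm (inj₁ (fx , moves-ux)) =
  moves-ux (trans (comm x) (cong (u ⟨$⟩ʳ_) fx))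
commuting-not-separating c u x comm (inj₂ (moves-x , fixes-ux)) =
  moves-x (begin
    c ⟨$⟩ʳ x                          ≡⟨ sym (inverseˡ u) ⟩
    u ⟨$⟩ˡ (u ⟨$⟩ʳ (c ⟨$⟩ʳ x))        ≡⟨ cong (u ⟨$⟩ˡ_) (sym (comm x)) ⟩
    u ⟨$⟩ˡ (c ⟨$⟩ʳ (u ⟨$⟩ʳ x))        ≡⟨ cong (u ⟨$⟩ˡ_) fixes-ux ⟩
    u ⟨$⟩ˡ (u ⟨$⟩ʳ x)                 ≡⟨ inverseˡ u ⟩
    x                                 ∎)
  where open ≡-Reasoning

-- For n ≥ 4, a permutation commuting with every even permutation is the
-- identity: a moved point x would be separated from u x by an even c.
central-is-identity : ∀ m (u : Permutation′ (suc (suc (suc (suc m))))) →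
  (∀ c → InA c → Commute c u) → u ≈ id
central-is-identity m u central x with u ⟨$⟩ʳ x ≟ x
... | yes fixed = fixed
... | no moved with separable m x (u ⟨$⟩ʳ x) (moved ∘ sym)
...   | c , even , separates =
  ⊥-elim (commuting-not-separating c u x (central c even) separates)

-- The identity is a power of every w, so it is adjacent to every other vertex.
id-dominating : ∀ {n} → Dominating {n} id
id-dominating v even v≉id =
  (λ id≈v → v≉id (sym ∘ id≈v)) , v , even , (0 , λ _ → refl) , (1 , λ _ → refl)

mainTheorem18 : (n : ℕ) → 4 ≤ n →
    (InA {n} id × Dominating {n} id)
    × ((u : Permutation′ n) → InA u → Dominating u → u ≈ id)
mainTheorem18 n@(suc (suc (suc (suc m)))) (s≤s (s≤s (s≤s (s≤s _)))) =
  (even-id {n} , id-dominating) ,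
  λ u _ dom → central-is-identity m u (λ c → dominating-commutes u c dom)
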